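{- Let $S$ be a symmetric numerical semigroup with Frobenius number $F(S)$. Then $\sigma(s) = \sigma(F(S) - s) - \frac{1}{2}$ for every $s \in S$ with $s \leq F(S)$.
   Context: A numerical semigroup is a subset $S \subseteq \mathbb{N} = \{0,1,2,\ldots\}$ closed under addition, containing $0$, with finite complement; $F(S) := \max(\mathbb{N}\setminus S)$, $g(S) := |\mathbb{N}\setminus S|$. $S$ is symmetric if $F(S)+1 = 2g(S)$. For a nonnegative integer $x$, $\sigma(x) := \frac{x}{2} - |S \cap [0,x]| + 1$. -}

module Defs where

open import Data.Nat using (ℕ; zero; suc; _+_; _*_; _∸_; _≤_; _<_)
open import Data.Integer using (+_)
open import Data.Rational using (ℚ; _/_; _-_) renaming (_+_ to _+ℚ_)
open import Data.Product using (Σ; _×_)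
open import Relation.Nullary using (¬_; Dec; yes; no)
open import Relation.Binary.PropositionalEquality using (_≡_)

record NumericalSemigroup : Set₁ where
  field
    _∈S      : ℕ → Set
    dec      : (n : ℕ) → Dec (n ∈S)
    zero∈    : 0 ∈S
    +-closed : ∀ {a b} → a ∈S → b ∈S → (a + b) ∈S
    cofinite : Σ ℕ (λ b → ∀ n → b ≤ n → n ∈S)
open NumericalSemigroup public

countS : NumericalSemigroup → ℕ → ℕ
countS S zero with dec S zero
... | yes _ = 1
... | no  _ = 0
countS S (suc x) with dec S (suc x)
... | yes _ = suc (countS S x)
... | no  _ = countS S x

gapsUpTo : NumericalSemigroup → ℕ → ℕ
gapsUpTo S zero with dec S zero
... | yes _ = 0
... | no  _ = 1
gapsUpTo S (suc x) with dec S (suc x)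
... | yes _ = gapsUpTo S x
... | no  _ = suc (gapsUpTo S x)

IsFrobenius : NumericalSemigroup → ℕ → Set
IsFrobenius S F = ¬ (F ∈S') × (∀ n → F < n → n ∈S')
  where _∈S' = _∈S S

-- genus g(S) = |ℕ \ S|; every gap is ≤ F, so g(S) = gapsUpTo S F
genus : NumericalSemigroup → ℕ → ℕ
genus S F = gapsUpTo S F

IsSymmetric : NumericalSemigroup → ℕ → Set
IsSymmetric S F = F + 1 ≡ 2 * genus S F

σ : NumericalSemigroup → ℕ → ℚ
σ S x = ((+ x) / 2 - (+ countS S x) / 1) +ℚ (+ 1) / 1

-- Write c(x) = |S ∩ [0, x]|. For i ≤ F at most one of i and F ∸ i lies in S, since their sum F
-- does not. Summing over i ≤ F, the pairs contribute 2 c(F) = F + 1, as c(F) = F + 1 - g = g by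
-- symmetry; so every pair contributes exactly one, and c(k) + |S ∩ [F ∸ k, F]| = k + 1 for every k ≤ F.
-- Splitting S ∩ [0, F] at F ∸ s, which is a gap when s ∈ S, gives c(F ∸ s) + s + 1 = c(F) + c(s);
-- together with 2 c(F) = F + 1 this is σ(s) = σ(F ∸ s) - 1/2 after clearing the halves.
module Submission where

open import Defs

module ℚ-Arithmetic where

  open import Data.Nat as ℕ using (ℕ; suc)
  open import Data.Integer as ℤ using (+_)
  open import Data.Integer.Tactic.RingSolver as ℤ-Solver using ()
  open import Data.Rational
  open import Data.Rational.Properties
    using (+-*-commutativeRing; _≟_; +-identityʳ; toℚᵘ-injective; toℚᵘ-fromℚᵘ; toℚᵘ-homo-+; toℚᵘ-homo-*)
  import Data.Rational.Unnormalised as ℚᵘ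
  import Data.Rational.Unnormalised.Properties as ℚᵘ
  open import Data.List using (_∷_; [])
  open import Level using (0ℓ)
  open import Relation.Nullary.Decidable using (dec⇒maybe)
  open import Tactic.RingSolver using (solve-∀; solve)
  open import Tactic.RingSolver.Core.AlmostCommutativeRing using (AlmostCommutativeRing; fromCommutativeRing)
  open import Relation.Binary.PropositionalEquality using (_≡_; refl; sym; trans; cong; module ≡-Reasoning)

  ℚ-ring : AlmostCommutativeRing 0ℓ 0ℓ
  ℚ-ring = fromCommutativeRing +-*-commutativeRing (λ p → dec⇒maybe (0ℚ ≟ p))

  -- The difference of the two sides is a linear combination of the defects of the three hypotheses.
  half-identity : ∀ {h s g b n a} → h + h ≡ 1ℚ → g + s + 1ℚ ≡ n + n → b + s + 1ℚ ≡ n + a →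
                  s * h - a + 1ℚ ≡ g * h - b + 1ℚ - h
  half-identity {h} {s} {g} {b} {n} {a} h+h≡1 g+s+1≡n+n b+s+1≡n+a = begin
    s * h - a + 1ℚ                                                  ≡⟨ expand h s g b n a ⟩
    g * h - b + 1ℚ - h + defect (g + s + 1ℚ) (b + s + 1ℚ) (h + h) ≡⟨ cong (λ e → g * h - b + 1ℚ - h + e) vanishes ⟩
    g * h - b + 1ℚ - h + 0ℚ                                         ≡⟨ +-identityʳ _ ⟩
    g * h - b + 1ℚ - h                                              ∎
    where
    open ≡-Reasoning
    defect : ℚ → ℚ → ℚ → ℚ
    defect x y z = (y - (n + a)) - h * (x - (n + n)) + (s + 1ℚ - n) * (z - 1ℚ)
    expand : ∀ h s g b n a → s * h - a + 1ℚ ≡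
             g * h - b + 1ℚ - h + ((b + s + 1ℚ - (n + a)) - h * (g + s + 1ℚ - (n + n)) + (s + 1ℚ - n) * (h + h - 1ℚ))
    expand = solve-∀ ℚ-ring
    vanishes : defect (g + s + 1ℚ) (b + s + 1ℚ) (h + h) ≡ 0ℚ
    vanishes rewrite g+s+1≡n+n | b+s+1≡n+a | h+h≡1 = solve (h ∷ s ∷ n ∷ a ∷ []) ℚ-ring

  ι : ℕ → ℚ
  ι n = + n / 1

  toℚᵘ-/ : ∀ i d → toℚᵘ (i / suc d) ℚᵘ.≃ ℚᵘ.mkℚᵘ i d
  toℚᵘ-/ i d = toℚᵘ-fromℚᵘ (ℚᵘ.mkℚᵘ i d)

  ι-+ : ∀ m n → ι (m ℕ.+ n) ≡ ι m + ι n
  ι-+ m n = toℚᵘ-injective (begin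
    toℚᵘ (ι (m ℕ.+ n))                   ≈⟨ toℚᵘ-/ (+ (m ℕ.+ n)) 0 ⟩
    ℚᵘ.mkℚᵘ (+ m ℤ.+ + n) 0              ≈⟨ ℚᵘ.*≡* (distrib (+ m) (+ n)) ⟩
    ℚᵘ.mkℚᵘ (+ m) 0 ℚᵘ.+ ℚᵘ.mkℚᵘ (+ n) 0 ≈⟨ ℚᵘ.+-cong (toℚᵘ-/ (+ m) 0) (toℚᵘ-/ (+ n) 0) ⟨
    toℚᵘ (ι m) ℚᵘ.+ toℚᵘ (ι n)           ≈⟨ toℚᵘ-homo-+ (ι m) (ι n) ⟨
    toℚᵘ (ι m + ι n)                     ∎)
    where
    open ℚᵘ.≃-Reasoning
    distrib : ∀ i j → (i ℤ.+ j) ℤ.* (+ 1 ℤ.* + 1) ≡ (i ℤ.* + 1 ℤ.+ j ℤ.* + 1) ℤ.* + 1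
    distrib = ℤ-Solver.solve-∀

  /2≡*½ : ∀ n → + n / 2 ≡ ι n * ½
  /2≡*½ n = toℚᵘ-injective (begin
    toℚᵘ (+ n / 2)                       ≈⟨ toℚᵘ-/ (+ n) 1 ⟩
    ℚᵘ.mkℚᵘ (+ n) 1                       ≈⟨ ℚᵘ.*≡* (reassoc (+ n)) ⟩
    ℚᵘ.mkℚᵘ (+ n) 0 ℚᵘ.* ℚᵘ.mkℚᵘ (+ 1) 1 ≈⟨ ℚᵘ.*-cong (toℚᵘ-/ (+ n) 0) (toℚᵘ-/ (+ 1) 1) ⟨
    toℚᵘ (ι n) ℚᵘ.* toℚᵘ ½                ≈⟨ toℚᵘ-homo-* (ι n) ½ ⟨
    toℚᵘ (ι n * ½)                       ∎)
    where
    open ℚᵘ.≃-Reasoning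
    reassoc : ∀ i → i ℤ.* (+ 1 ℤ.* + 2) ≡ (i ℤ.* + 1) ℤ.* + 2
    reassoc = ℤ-Solver.solve-∀

  ι-+-+1 : ∀ m n → ι (m ℕ.+ n ℕ.+ 1) ≡ ι m + ι n + 1ℚ
  ι-+-+1 m n = trans (ι-+ (m ℕ.+ n) 1) (cong (_+ 1ℚ) (ι-+ m n))

  σ≡ι : ∀ S x → σ S x ≡ ι x * ½ - ι (countS S x) + 1ℚ
  σ≡ι S x = cong (λ q → q - ι (countS S x) + 1ℚ) (/2≡*½ x)

  ι-half-identity : ∀ s g b n a → g ℕ.+ s ℕ.+ 1 ≡ n ℕ.+ n → b ℕ.+ s ℕ.+ 1 ≡ n ℕ.+ a →
                    ι s * ½ - ι a + 1ℚ ≡ ι g * ½ - ι b + 1ℚ - ½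
  ι-half-identity s g b n a g+s+1 b+s+1 = half-identity {½} {ι s} {ι g} {ι b} {ι n} {ι a} refl
    (trans (sym (ι-+-+1 g s)) (trans (cong ι g+s+1) (ι-+ n n)))
    (trans (sym (ι-+-+1 b s)) (trans (cong ι b+s+1) (ι-+ n a)))

open ℚ-Arithmetic using (σ≡ι; ι-half-identity)
open import Data.Nat using (ℕ; zero; suc; _+_; _*_; _∸_; _≤_; z≤n; s≤s)
open import Data.Nat.Properties
  using (+-comm; +-assoc; +-suc; +-identityʳ; +-cancelˡ-≡; +-cancelʳ-≡; +-monoˡ-≤; +-mono-≤;
         ≤-refl; ≤-trans; ≤-antisym; ≤-reflexive; ≤-pred; m≤n⇒m≤1+n; m≤n⇒m<n∨m≡n; m+n∸n≡m; m∸n+n≡m; m+[n∸m]≡n;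
         +-commutativeSemigroup)
open import Algebra.Properties.CommutativeSemigroup +-commutativeSemigroup using (interchange; x∙yz≈y∙xz; x∙yz≈xz∙y)
open import Data.Product using (proj₁)
open import Data.Sum using (inj₁; inj₂)
open import Data.Empty using (⊥-elim)
open import Relation.Nullary using (¬_; yes; no)
open import Relation.Binary.PropositionalEquality
  using (_≡_; refl; sym; trans; cong; cong₂; subst; module ≡-Reasoning)
open import Data.Rational using (½; _-_)

sumTo : (ℕ → ℕ) → ℕ → ℕ
sumTo f zero    = f zero
sumTo f (suc k) = f (suc k) + sumTo f k

sumTo-+ : ∀ f g k → sumTo (λ i → f i + g i) k ≡ sumTo f k + sumTo g k
sumTo-+ f g zero    = refl
sumTo-+ f g (suc k) =
  trans (cong (f (suc k) + g (suc k) +_) (sumTo-+ f g k)) (interchange (f (suc k)) _ _ _)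

sumTo-≤ : ∀ f n → (∀ i → i ≤ n → f i ≤ 1) → sumTo f n ≤ suc n
sumTo-≤ f zero    f≤1 = f≤1 zero z≤n
sumTo-≤ f (suc n) f≤1 =
  +-mono-≤ (f≤1 (suc n) ≤-refl) (sumTo-≤ f n (λ i i≤n → f≤1 i (m≤n⇒m≤1+n i≤n)))

sumTo-saturated : ∀ f n → (∀ i → i ≤ n → f i ≤ 1) → sumTo f n ≡ suc n →
                  ∀ {k} → k ≤ n → sumTo f k ≡ suc k
sumTo-saturated f zero    _   total z≤n = total
sumTo-saturated f (suc n) f≤1 total k≤1+n with m≤n⇒m<n∨m≡n k≤1+n
... | inj₂ refl      = total
... | inj₁ (s≤s k≤n) = sumTo-saturated f n f≤1′ prefix k≤n
  where
  f≤1′ : ∀ i → i ≤ n → f i ≤ 1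
  f≤1′ i i≤n = f≤1 i (m≤n⇒m≤1+n i≤n)
  prefix : sumTo f n ≡ suc n
  prefix = ≤-antisym (sumTo-≤ f n f≤1′)
    (≤-pred (≤-trans (≤-reflexive (sym total)) (+-monoˡ-≤ (sumTo f n) (f≤1 (suc n) ≤-refl))))

sumTo-reflect : ∀ f {n} j k → j + k ≡ n →
                sumTo f j + sumTo (λ i → f (n ∸ i)) k ≡ sumTo f n + f j
sumTo-reflect f j zero eq with refl ← trans (sym (+-identityʳ j)) eq = refl
sumTo-reflect f j (suc k) refl rewrite m+n∸n≡m j (suc k) = begin
  sumTo f j + (f j + R)    ≡⟨ x∙yz≈y∙xz (sumTo f j) (f j) R ⟩
  f j + (sumTo f j + R)    ≡⟨ cong (f j +_) shifted ⟩
  f j + sumTo f (j + suc k) ≡⟨ +-comm (f j) _ ⟩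
  sumTo f (j + suc k) + f j ∎
  where
  open ≡-Reasoning
  R = sumTo (λ i → f (j + suc k ∸ i)) k
  shifted : sumTo f j + R ≡ sumTo f (j + suc k)
  shifted = +-cancelˡ-≡ (f (suc j)) _ _ (trans (sym (+-assoc (f (suc j)) _ R))
    (trans (sumTo-reflect f (suc j) k (sym (+-suc j k))) (+-comm _ (f (suc j)))))

sumTo-reverse : ∀ f n → sumTo (λ i → f (n ∸ i)) n ≡ sumTo f n
sumTo-reverse f n = +-cancelˡ-≡ (f 0) _ _ (trans (sumTo-reflect f 0 n refl) (+-comm _ (f 0)))

indicator : NumericalSemigroup → ℕ → ℕ
indicator S x with dec S x
... | yes _ = 1
... | no  _ = 0

indicator≤1 : ∀ S x → indicator S x ≤ 1
indicator≤1 S x with dec S x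
... | yes _ = s≤s z≤n
... | no  _ = z≤n

indicator-∉ : ∀ S {x} → ¬ _∈S S x → indicator S x ≡ 0
indicator-∉ S {x} x∉S with dec S x
... | yes x∈S = ⊥-elim (x∉S x∈S)
... | no  _   = refl

countS≡sumTo : ∀ S x → countS S x ≡ sumTo (indicator S) x
countS≡sumTo S zero with dec S zero
... | yes _ = refl
... | no  _ = refl
countS≡sumTo S (suc x) with dec S (suc x)
... | yes _ = cong suc (countS≡sumTo S x)
... | no  _ = countS≡sumTo S x

countS+gapsUpTo : ∀ S x → countS S x + gapsUpTo S x ≡ suc x
countS+gapsUpTo S zero with dec S zero
... | yes _ = refl
... | no  _ = refl
countS+gapsUpTo S (suc x) with dec S (suc x)
... | yes _ = cong suc (countS+gapsUpTo S x)
... | no  _ = trans (+-suc (countS S x) _) (cong suc (countS+gapsUpTo S x))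

module _ (S : NumericalSemigroup) {F : ℕ} (frob : IsFrobenius S F) where

  ∈⇒reflection∉ : ∀ {x} → x ≤ F → _∈S S x → ¬ _∈S S (F ∸ x)
  ∈⇒reflection∉ x≤F x∈S Fx∈S = proj₁ frob (subst (_∈S S) (m+[n∸m]≡n x≤F) (+-closed S x∈S Fx∈S))

  indicator-pair≤1 : ∀ x → x ≤ F → indicator S x + indicator S (F ∸ x) ≤ 1
  indicator-pair≤1 x x≤F with dec S x
  ... | yes x∈S rewrite indicator-∉ S (∈⇒reflection∉ x≤F x∈S) = s≤s z≤n
  ... | no  _   = indicator≤1 S (F ∸ x)

  module _ (symm : IsSymmetric S F) where

    countS≡genus : countS S F ≡ genus S F
    countS≡genus = +-cancelʳ-≡ (genus S F) _ _ (begin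
      countS S F + genus S F     ≡⟨ countS+gapsUpTo S F ⟩
      suc F                      ≡⟨ +-comm 1 F ⟩
      F + 1                      ≡⟨ symm ⟩
      2 * genus S F              ≡⟨ cong (genus S F +_) (+-identityʳ _) ⟩
      genus S F + genus S F      ∎)
      where open ≡-Reasoning

    countS+countS : countS S F + countS S F ≡ suc F
    countS+countS = trans (cong (countS S F +_) countS≡genus) (countS+gapsUpTo S F)

    -- #{i ≤ k : i ∈ S} + #{i ≤ k : F ∸ i ∈ S} = k + 1, since for i ≤ F exactly one of i, F ∸ i lies in S.
    countS+reflected : ∀ {k} → k ≤ F → countS S k + sumTo (λ i → indicator S (F ∸ i)) k ≡ suc k
    countS+reflected {k} k≤F = begin
      countS S k + sumTo b̄ k                        ≡⟨ cong (_+ sumTo b̄ k) (countS≡sumTo S k) ⟩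
      sumTo b k + sumTo b̄ k                         ≡⟨ sumTo-+ b b̄ k ⟨
      sumTo (λ i → b i + b̄ i) k                    ≡⟨ sumTo-saturated _ F indicator-pair≤1 total k≤F ⟩
      suc k                                         ∎
      where
      open ≡-Reasoning
      b b̄ : ℕ → ℕ
      b    = indicator S
      b̄ i = indicator S (F ∸ i)
      total : sumTo (λ i → b i + b̄ i) F ≡ suc F
      total = begin
        sumTo (λ i → b i + b̄ i) F ≡⟨ sumTo-+ b b̄ F ⟩
        sumTo b F + sumTo b̄ F      ≡⟨ cong (sumTo b F +_) (sumTo-reverse b F) ⟩
        sumTo b F + sumTo b F      ≡⟨ cong₂ _+_ (countS≡sumTo S F) (countS≡sumTo S F) ⟨
        countS S F + countS S F    ≡⟨ countS+countS ⟩
        suc F                      ∎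

    countS-reflect : ∀ {s} → _∈S S s → s ≤ F → countS S (F ∸ s) + s + 1 ≡ countS S F + countS S s
    countS-reflect {s} s∈S s≤F = begin
      countS S (F ∸ s) + s + 1                     ≡⟨ +-assoc (countS S (F ∸ s)) s 1 ⟩
      countS S (F ∸ s) + (s + 1)                   ≡⟨ cong (countS S (F ∸ s) +_) (+-comm s 1) ⟩
      countS S (F ∸ s) + suc s                     ≡⟨ cong (countS S (F ∸ s) +_) (countS+reflected s≤F) ⟨
      countS S (F ∸ s) + (countS S s + P)          ≡⟨ x∙yz≈xz∙y (countS S (F ∸ s)) (countS S s) P ⟩
      (countS S (F ∸ s) + P) + countS S s          ≡⟨ cong (_+ countS S s) head ⟩
      countS S F + countS S s                      ∎
      where
      open ≡-Reasoning
      P : ℕ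
      P = sumTo (λ i → indicator S (F ∸ i)) s
      head : countS S (F ∸ s) + P ≡ countS S F
      head = begin
        countS S (F ∸ s) + P                       ≡⟨ cong (_+ P) (countS≡sumTo S (F ∸ s)) ⟩
        sumTo (indicator S) (F ∸ s) + P            ≡⟨ sumTo-reflect (indicator S) (F ∸ s) s (m∸n+n≡m s≤F) ⟩
        sumTo (indicator S) F + indicator S (F ∸ s) ≡⟨ cong₂ _+_ (sym (countS≡sumTo S F)) (indicator-∉ S (∈⇒reflection∉ s≤F s∈S)) ⟩
        countS S F + 0                             ≡⟨ +-identityʳ _ ⟩
        countS S F                                 ∎

corollary2p12 : (S : NumericalSemigroup) (F : ℕ) → IsFrobenius S F → IsSymmetric S F →
    ∀ s → _∈S S s → s ≤ F → σ S s ≡ σ S (F ∸ s) - ½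
corollary2p12 S F frob symm s s∈S s≤F =
  trans (σ≡ι S s)
    (trans (ι-half-identity s (F ∸ s) (countS S (F ∸ s)) (countS S F) (countS S s)
             F∸s+s+1 (countS-reflect S frob symm s∈S s≤F))
      (cong (_- ½) (sym (σ≡ι S (F ∸ s)))))
  where
  F∸s+s+1 : F ∸ s + s + 1 ≡ countS S F + countS S F
  F∸s+s+1 = trans (cong (_+ 1) (m∸n+n≡m s≤F)) (trans (+-comm F 1) (sym (countS+countS S frob symm)))
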